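{- Let $\Omega$ be a finite set and, for $1\leq k\leq|\Omega|$, let $\mathcal{H}_{k,\Omega}$ be the complete hypergraph on $\Omega$, i.e. the hypergraph whose set of hyperedges is $\mathcal{U}_{k,\Omega}$. Then: (1) $\mathcal{F}_2(\mathcal{H}_{1,\Omega})=\mathcal{U}_{|\Omega|,\Omega}$ and $\mathcal{I}_2(\mathcal{H}_{1,\Omega})=\mathcal{U}_{1,\Omega}$; (2) for $2\leq k\leq|\Omega|-1$, $\mathcal{F}_2(\mathcal{H}_{k,\Omega})=\mathcal{U}_{|\Omega|-1,\Omega}$ and $\mathcal{I}_2(\mathcal{H}_{k,\Omega})=\mathcal{U}_{2,\Omega}$; (3) $\mathcal{F}_2(\mathcal{H}_{|\Omega|,\Omega})=\mathcal{U}_{1,\Omega}$ and $\mathcal{I}_2(\mathcal{H}_{|\Omega|,\Omega})=\mathcal{U}_{|\Omega|,\Omega}$.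
   Context: For a finite set $\Omega$, $\mathcal{U}_{k,\Omega}=\{A\subseteq\Omega: |A|=k\}$. A hypergraph $\mathcal{H}$ on $\Omega$ has vertex set $\Omega$ and a clutter of hyperedges (subsets of $\Omega$, none containing another). Vertices are colored black or white. Rule $\mathcal{R}_2$: at each step, a non-empty set $X$ of black vertices contained in a hyperedge $E$, such that $X$ is not contained in any other hyperedge containing white vertices, forces all white vertices of $E$ to become black; iterating until no change is possible from an initial black set $B$ gives a final black set $\mathcal{R}_2^\ast(B)$ independent of the order of steps. An $\mathcal{R}_2$-forcing set is a non-empty $F\subseteq\Omega$ with $\mathcal{R}_2^\ast(F)=\Omega$; an $\mathcal{R}_2$-immune set is a non-empty $I\subseteq\Omega$ with $\mathcal{R}_2^\ast(\Omega\setminus I)=\Omega\setminus I$. $\mathcal{F}_2(\mathcal{H})$ and $\mathcal{I}_2(\mathcal{H})$ denote the families of inclusion-minimal $\mathcal{R}_2$-forcing sets and inclusion-minimal $\mathcal{R}_2$-immune sets. -}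

module Defs where

open import Data.Nat using (ℕ)
open import Data.Fin using (Fin)
open import Data.Fin.Subset using (Subset; _∈_; _∉_; _⊆_; _∪_; ∁; ⊤; ∣_∣; Nonempty)
open import Data.Product using (Σ; ∃; _×_; _,_)
open import Relation.Binary.PropositionalEquality using (_≡_; _≢_)
open import Relation.Nullary using (¬_)
open import Function.Bundles using (_⇔_)
open import Level using (0ℓ; suc)

-- Ω is modelled as Fin n; subsets of Ω as Subset n (= Vec Bool n).
-- A hypergraph on Ω is given by the predicate "is a hyperedge".
Hypergraph : ℕ → Set₁
Hypergraph n = Subset n → Set

U : (n k : ℕ) → Subset n → Set
U n k A = ∣ A ∣ ≡ k

complete : (n k : ℕ) → Hypergraph n
complete n k = U n k

HasWhite : ∀ {n} → Subset n → Subset n → Set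
HasWhite S E = ∃ λ v → v ∈ E × v ∉ S

-- One application of rule R2: black set S becomes S'
-- (X ⊆ S non-empty, X ⊆ E hyperedge, X not contained in any other hyperedge
--  containing white vertices; all white vertices of E become black)
Step : ∀ {n} → Hypergraph n → Subset n → Subset n → Set
Step H S S' =
  Σ _ λ E → Σ _ λ X →
    H E × Nonempty X × X ⊆ S × X ⊆ E ×
    (∀ E' → H E' → E' ≢ E → HasWhite S E' → ¬ (X ⊆ E')) ×
    S' ≡ S ∪ E

data Reach {n} (H : Hypergraph n) (B : Subset n) : Subset n → Set where
  done : Reach H B B
  step : ∀ {S S'} → Reach H B S → Step H S S' → Reach H B S'

IsClosure : ∀ {n} → Hypergraph n → Subset n → Subset n → Set
IsClosure H B S = Reach H B S × (∀ S' → Step H S S' → S' ≡ S)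

-- R2*(B) = C  (the final set is independent of order; we require every
-- final set reached from B to equal C)
ClosureIs : ∀ {n} → Hypergraph n → Subset n → Subset n → Set
ClosureIs H B C = ∀ S → IsClosure H B S → S ≡ C

Forcing : ∀ {n} → Hypergraph n → Subset n → Set
Forcing H F = Nonempty F × ClosureIs H F ⊤

Immune : ∀ {n} → Hypergraph n → Subset n → Set
Immune H I = Nonempty I × ClosureIs H (∁ I) (∁ I)

Minimal : ∀ {n} → (Subset n → Set) → Subset n → Set
Minimal P A = P A × (∀ B → B ⊆ A → P B → B ≡ A)

F₂ : ∀ {n} → Hypergraph n → Subset n → Set
F₂ H = Minimal (Forcing H)

I₂ : ∀ {n} → Hypergraph n → Subset n → Set
I₂ H = Minimal (Immune H)

_≐_ : ∀ {n} → (Subset n → Set) → (Subset n → Set) → Set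
P ≐ Q = ∀ A → P A ⇔ Q A
infix 4 _≐_

-- In the complete k-uniform hypergraph the outcome of R₂ depends only on the number of
-- black vertices: there is a threshold m such that every black set of size at least m
-- is forced to all of Ω, while on every smaller black set each applicable step adds
-- nothing.  For k = 1 the threshold is n, since a hyperedge {x} has no white vertex
-- once x is black; for k = n it is 1, since Ω is the only hyperedge.  For 2 ≤ k < n it
-- is n - 1: with a single white vertex w, any k - 1 black vertices together with w
-- form the only hyperedge containing them that has a white vertex; with two white
-- vertices, a hyperedge E with a white vertex w can have w exchanged for a vertex
-- outside E, giving a second hyperedge that still contains the same black vertices
-- and a white one.  Forcing sets are then exactly the sets of size ≥ m, immune sets
-- (whose complements must be stuck) those of size ≥ n + 1 - m, and the minimal ones
-- have exactly these sizes.
module Submission where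

open import Defs
open import Data.Nat using (ℕ; zero; suc; _≤_; _<_; _+_; _∸_; z≤n; s≤s; s≤s⁻¹; _≤?_)
open import Data.Nat.Properties
open import Data.Product using (_×_; _,_; proj₁; proj₂; ∃-syntax)
open import Data.Sum using (_⊎_; inj₁; inj₂; [_,_]′)
open import Data.Empty using (⊥-elim)
open import Data.Fin using (Fin; zero; suc)
open import Data.Fin.Subset
  using (Subset; _∈_; _∉_; _⊆_; _∪_; _-_; ∁; ⊤; ⊥; ∣_∣; Nonempty; ⁅_⁆; inside; outside)
open import Data.Fin.Subset.Properties
open import Data.Vec using ([]; _∷_; here; there)
open import Relation.Binary.PropositionalEquality
open import Relation.Nullary using (¬_; yes; no)
open import Function.Base using (_∘_)
open import Function.Bundles using (_⇔_; mk⇔; Equivalence)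

private variable
  n : ℕ
  p q : Subset n
  x y : Fin n

∃⊆-of-size : ∀ (p : Subset n) {k} → k ≤ ∣ p ∣ → ∃[ q ] q ⊆ p × ∣ q ∣ ≡ k
∃⊆-of-size         []            {zero}  _   = [] , (λ ()) , refl
∃⊆-of-size         (outside ∷ p)         k≤p with ∃⊆-of-size p k≤p
... | q , q⊆p , ∣q∣≡k = outside ∷ q , out⊆ q⊆p , ∣q∣≡k
∃⊆-of-size {n}     (inside ∷ p)  {zero}  _   = ⊥ , ⊥⊆ , ∣⊥∣≡0 n
∃⊆-of-size         (inside ∷ p)  {suc k} k≤p with ∃⊆-of-size p (s≤s⁻¹ k≤p)
... | q , q⊆p , ∣q∣≡k = inside ∷ q , s⊆s q⊆p , cong suc ∣q∣≡k

p⊆q∧∣q∣≤∣p∣⇒p≡q : p ⊆ q → ∣ q ∣ ≤ ∣ p ∣ → p ≡ q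
p⊆q∧∣q∣≤∣p∣⇒p≡q {p = []}          {[]}          _   _ = refl
p⊆q∧∣q∣≤∣p∣⇒p≡q {p = inside ∷ p}  {inside ∷ q}  p⊆q q≤p =
  cong (inside ∷_) (p⊆q∧∣q∣≤∣p∣⇒p≡q (drop-∷-⊆ p⊆q) (s≤s⁻¹ q≤p))
p⊆q∧∣q∣≤∣p∣⇒p≡q {p = outside ∷ p} {outside ∷ q} p⊆q q≤p =
  cong (outside ∷_) (p⊆q∧∣q∣≤∣p∣⇒p≡q (drop-∷-⊆ p⊆q) q≤p)
p⊆q∧∣q∣≤∣p∣⇒p≡q {p = inside ∷ p}  {outside ∷ q} p⊆q _ with p⊆q here
... | ()
p⊆q∧∣q∣≤∣p∣⇒p≡q {p = outside ∷ p} {inside ∷ q}  p⊆q q≤p =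
  ⊥-elim (1+n≰n (≤-trans q≤p (p⊆q⇒∣p∣≤∣q∣ (drop-∷-⊆ p⊆q))))

1≤∣p∣⇒Nonempty : ∀ (p : Subset n) → 1 ≤ ∣ p ∣ → Nonempty p
1≤∣p∣⇒Nonempty (inside ∷ p)  _   = zero , here
1≤∣p∣⇒Nonempty (outside ∷ p) 1≤p with 1≤∣p∣⇒Nonempty p 1≤p
... | x , x∈p = suc x , there x∈p

Nonempty⇒1≤∣p∣ : Nonempty p → 1 ≤ ∣ p ∣
Nonempty⇒1≤∣p∣ {p = inside ∷ p}  _               = s≤s z≤n
Nonempty⇒1≤∣p∣ {p = outside ∷ p} (_ , there x∈p) = Nonempty⇒1≤∣p∣ (_ , x∈p)

∣p∣<n⇒∃∉ : ∀ (p : Subset n) → ∣ p ∣ < n → ∃[ x ] x ∉ p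
∣p∣<n⇒∃∉ (outside ∷ p) _ = zero , λ ()
∣p∣<n⇒∃∉ (inside ∷ p)  p<n with ∣p∣<n⇒∃∉ p (s≤s⁻¹ p<n)
... | x , x∉p = suc x , x∉p ∘ drop-there

x∈p⇒⁅x⁆⊆p : x ∈ p → ⁅ x ⁆ ⊆ p
x∈p⇒⁅x⁆⊆p {x = x} {p = p} x∈p y∈⁅x⁆ = subst (_∈ p) (sym (x∈⁅y⁆⇒x≡y x y∈⁅x⁆)) x∈p

q⊆p⇒p∪q≡p : q ⊆ p → p ∪ q ≡ p
q⊆p⇒p∪q≡p {q = q} {p = p} q⊆p =
  ⊆-antisym (λ x∈p∪q → [ (λ x∈p → x∈p) , q⊆p ]′ (x∈p∪q⁻ p q x∈p∪q)) (p⊆p∪q q)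

x∉p⇒∣p∪⁅x⁆∣≡1+∣p∣ : x ∉ p → ∣ p ∪ ⁅ x ⁆ ∣ ≡ suc ∣ p ∣
x∉p⇒∣p∪⁅x⁆∣≡1+∣p∣ {x = zero}  {p = inside ∷ p}  x∉p = ⊥-elim (x∉p here)
x∉p⇒∣p∪⁅x⁆∣≡1+∣p∣ {x = zero}  {p = outside ∷ p} _   = cong (suc ∘ ∣_∣) (∪-identityʳ p)
x∉p⇒∣p∪⁅x⁆∣≡1+∣p∣ {x = suc x} {p = inside ∷ p}  x∉p =
  cong suc (x∉p⇒∣p∪⁅x⁆∣≡1+∣p∣ (x∉p ∘ there))
x∉p⇒∣p∪⁅x⁆∣≡1+∣p∣ {x = suc x} {p = outside ∷ p} x∉p = x∉p⇒∣p∪⁅x⁆∣≡1+∣p∣ (x∉p ∘ there)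

x∈p⇒1+∣p-x∣≡∣p∣ : x ∈ p → suc ∣ p - x ∣ ≡ ∣ p ∣
x∈p⇒1+∣p-x∣≡∣p∣ {x = zero}  {p = inside ∷ p}  _           = cong (suc ∘ ∣_∣) (p─⊥≡p p)
x∈p⇒1+∣p-x∣≡∣p∣ {x = suc x} {p = inside ∷ p}  (there x∈p) = cong suc (x∈p⇒1+∣p-x∣≡∣p∣ x∈p)
x∈p⇒1+∣p-x∣≡∣p∣ {x = suc x} {p = outside ∷ p} (there x∈p) = x∈p⇒1+∣p-x∣≡∣p∣ x∈p

x∈p∧y∉p⇒∣p-x∪⁅y⁆∣≡∣p∣ : x ∈ p → y ∉ p → ∣ (p - x) ∪ ⁅ y ⁆ ∣ ≡ ∣ p ∣
x∈p∧y∉p⇒∣p-x∪⁅y⁆∣≡∣p∣ {p = p} x∈p y∉p =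
  trans (x∉p⇒∣p∪⁅x⁆∣≡1+∣p∣ (y∉p ∘ p─q⊆p p _)) (x∈p⇒1+∣p-x∣≡∣p∣ x∈p)

∣p∣<n∧x∉p⇒∃∉≢ : ∀ (p : Subset (suc n)) → ∣ p ∣ < n → x ∉ p → ∃[ y ] y ∉ p × y ≢ x
∣p∣<n∧x∉p⇒∃∉≢ {n} {x} p p<n x∉p with ∣p∣<n⇒∃∉ (p ∪ ⁅ x ⁆) p∪⁅x⁆<1+n
  where
  p∪⁅x⁆<1+n : ∣ p ∪ ⁅ x ⁆ ∣ < suc n
  p∪⁅x⁆<1+n = subst (_< suc n) (sym (x∉p⇒∣p∪⁅x⁆∣≡1+∣p∣ x∉p)) (s≤s p<n)
... | y , y∉p∪⁅x⁆ = y , y∉p∪⁅x⁆ ∘ p⊆p∪q ⁅ x ⁆ , x∉⁅y⁆⇒x≢y (y∉p∪⁅x⁆ ∘ q⊆p∪q p ⁅ x ⁆)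

∣∁p∣+∣p∣≡n : ∀ (p : Subset n) → ∣ ∁ p ∣ + ∣ p ∣ ≡ n
∣∁p∣+∣p∣≡n p = trans (cong (_+ ∣ p ∣) (∣∁p∣≡n∸∣p∣ p)) (m∸n+n≡m (∣p∣≤n p))

c<m⇔t≤i : ∀ {t m c i} → t + m ≡ suc (c + i) → c < m ⇔ t ≤ i
c<m⇔t≤i {t} {m} {c} {i} t+m≡1+c+i = mk⇔
  (λ c<m → +-cancelʳ-≤ m t i (begin
    t + m       ≡⟨ t+m≡1+c+i ⟩
    suc c + i   ≤⟨ +-monoˡ-≤ i c<m ⟩
    m + i       ≡⟨ +-comm m i ⟩
    i + m       ∎))
  (λ t≤i → +-cancelʳ-≤ i (suc c) m (begin
    suc c + i   ≡⟨ t+m≡1+c+i ⟨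
    t + m       ≤⟨ +-monoˡ-≤ m t≤i ⟩
    i + m       ≡⟨ +-comm i m ⟩
    m + i       ∎))
  where open ≤-Reasoning

t+m≡1+n∧m≤n⇒1≤t : ∀ {t m} → t + m ≡ suc n → m ≤ n → 1 ≤ t
t+m≡1+n∧m≤n⇒1≤t {t = zero}  refl m≤n = ⊥-elim (1+n≰n m≤n)
t+m≡1+n∧m≤n⇒1≤t {t = suc _} _    _   = s≤s z≤n

Stuck : Hypergraph n → Subset n → Set
Stuck H S = ∀ S' → Step H S S' → S' ≡ S

ClosesTo⊤ : Hypergraph n → Subset n → Set
ClosesTo⊤ H B = IsClosure H B ⊤ × ClosureIs H B ⊤

Threshold : Hypergraph n → ℕ → Set
Threshold H m = ∀ B → (m ≤ ∣ B ∣ → ClosesTo⊤ H B) × (∣ B ∣ < m → Stuck H B)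

module _ {H : Hypergraph n} where

  stuck-if-edges-⊆ : ∀ {S} → (∀ {S'} (s : Step H S S') → proj₁ s ⊆ S) → Stuck H S
  stuck-if-edges-⊆ edges⊆S S' s@(_ , _ , _ , _ , _ , _ , _ , S'≡S∪E) =
    trans S'≡S∪E (q⊆p⇒p∪q≡p (edges⊆S s))

  Step⇒⊆ : ∀ {S S'} → Step H S S' → S ⊆ S'
  Step⇒⊆ (E , _ , _ , _ , _ , _ , _ , S'≡S∪E) x∈S = subst (_ ∈_) (sym S'≡S∪E) (p⊆p∪q E x∈S)

  Reach⇒⊆ : ∀ {B S} → Reach H B S → B ⊆ S
  Reach⇒⊆ done       = λ x∈B → x∈B
  Reach⇒⊆ (step r s) = Step⇒⊆ s ∘ Reach⇒⊆ r

  Stuck∧Reach⇒≡ : ∀ {B S} → Stuck H B → Reach H B S → S ≡ B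
  Stuck∧Reach⇒≡ stuck done = refl
  Stuck∧Reach⇒≡ stuck (step {S' = S'} r s) with Stuck∧Reach⇒≡ stuck r
  ... | refl = stuck S' s

  Stuck⇒closure-self : ∀ {B} → Stuck H B → IsClosure H B B × ClosureIs H B B
  Stuck⇒closure-self stuck = (done , stuck) , λ _ (r , _) → Stuck∧Reach⇒≡ stuck r

  ⊤-stuck : Stuck H ⊤
  ⊤-stuck = stuck-if-edges-⊆ λ _ → ⊆⊤

  ⊤-closes : ClosesTo⊤ H ⊤
  ⊤-closes = Stuck⇒closure-self ⊤-stuck

  -- Having a white vertex is antitone in the black set, so a step stays
  -- applicable after more vertices have become black.
  Step-⊆ : ∀ {S T S'} → S ⊆ T → (s : Step H S S') → Step H T (T ∪ proj₁ s)
  Step-⊆ S⊆T (E , X , edge , nonempty , X⊆S , X⊆E , unique , _) =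
    E , X , edge , nonempty , S⊆T ∘ X⊆S , X⊆E ,
    (λ E' edge' E'≢E (v , v∈E' , v∉T) → unique E' edge' E'≢E (v , v∈E' , v∉T ∘ S⊆T)) ,
    refl

  Step⊤⇒ClosesTo⊤ : ∀ {B} → Step H B ⊤ → ClosesTo⊤ H B
  Step⊤⇒ClosesTo⊤ {B} s@(E , _ , _ , _ , _ , _ , _ , ⊤≡B∪E) =
    (step done s , ⊤-stuck) , final⊤
    where
    final⊤ : ClosureIs H B ⊤
    final⊤ S (r , stuck) = ⊆-antisym ⊆⊤ ⊤⊆S
      where
      S∪E≡S : S ∪ E ≡ S
      S∪E≡S = stuck (S ∪ E) (Step-⊆ (Reach⇒⊆ r) s)
      ⊤⊆S : ⊤ ⊆ S
      ⊤⊆S {x} x∈⊤ with x∈p∪q⁻ B E (subst (x ∈_) ⊤≡B∪E x∈⊤)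
      ... | inj₁ x∈B = Reach⇒⊆ r x∈B
      ... | inj₂ x∈E = subst (x ∈_) S∪E≡S (q⊆p∪q S E x∈E)

Minimal≐U : ∀ {P : Subset n → Set} {m} → (∀ B → P B ⇔ m ≤ ∣ B ∣) → Minimal P ≐ U n m
Minimal≐U {P = P} {m} P⇔m≤ A = mk⇔ minimal⇒size size⇒minimal
  where
  open Equivalence
  minimal⇒size : Minimal P A → ∣ A ∣ ≡ m
  minimal⇒size (PA , minimal) with ∃⊆-of-size A (to (P⇔m≤ A) PA)
  ... | B , B⊆A , ∣B∣≡m =
    subst (λ C → ∣ C ∣ ≡ m) (minimal B B⊆A (from (P⇔m≤ B) (≤-reflexive (sym ∣B∣≡m)))) ∣B∣≡m
  size⇒minimal : ∣ A ∣ ≡ m → Minimal P A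
  size⇒minimal ∣A∣≡m = from (P⇔m≤ A) (≤-reflexive (sym ∣A∣≡m)) , λ B B⊆A PB →
    p⊆q∧∣q∣≤∣p∣⇒p≡q B⊆A (subst (_≤ ∣ B ∣) (sym ∣A∣≡m) (to (P⇔m≤ B) PB))

module _ {H : Hypergraph n} {m} (threshold : Threshold H m) where

  Forcing⇔ : 1 ≤ m → m ≤ n → ∀ F → Forcing H F ⇔ m ≤ ∣ F ∣
  Forcing⇔ 1≤m m≤n F = mk⇔ forcing⇒size size⇒forcing
    where
    forcing⇒size : Forcing H F → m ≤ ∣ F ∣
    forcing⇒size (_ , closes⊤) with m ≤? ∣ F ∣
    ... | yes m≤F = m≤F
    ... | no m≰F with closes⊤ F (proj₁ (Stuck⇒closure-self (proj₂ (threshold F) (≰⇒> m≰F))))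
    ... | refl = ⊥-elim (m≰F (subst (m ≤_) (sym (∣⊤∣≡n n)) m≤n))
    size⇒forcing : m ≤ ∣ F ∣ → Forcing H F
    size⇒forcing m≤F = 1≤∣p∣⇒Nonempty F (≤-trans 1≤m m≤F) , proj₂ (proj₁ (threshold F) m≤F)

  Immune⇔ : ∀ {t} → t + m ≡ suc n → m ≤ n → ∀ I → Immune H I ⇔ t ≤ ∣ I ∣
  Immune⇔ {t} t+m≡1+n m≤n I = mk⇔ immune⇒size size⇒immune
    where
    ∁I<m⇔t≤I : ∣ ∁ I ∣ < m ⇔ t ≤ ∣ I ∣
    ∁I<m⇔t≤I = c<m⇔t≤i (trans t+m≡1+n (cong suc (sym (∣∁p∣+∣p∣≡n I))))
    open Equivalence ∁I<m⇔t≤I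
    immune⇒size : Immune H I → t ≤ ∣ I ∣
    immune⇒size ((x , x∈I) , closes-self) with m ≤? ∣ ∁ I ∣
    ... | yes m≤∁I = ⊥-elim (x∈p⇒x∉∁p x∈I
      (subst (x ∈_) (closes-self ⊤ (proj₁ (proj₁ (threshold (∁ I)) m≤∁I))) ∈⊤))
    ... | no m≰∁I = to (≰⇒> m≰∁I)
    size⇒immune : t ≤ ∣ I ∣ → Immune H I
    size⇒immune t≤I =
      1≤∣p∣⇒Nonempty I (≤-trans (t+m≡1+n∧m≤n⇒1≤t t+m≡1+n m≤n) t≤I) ,
      proj₂ (Stuck⇒closure-self (proj₂ (threshold (∁ I)) (from t≤I)))

  Threshold⇒F₂≐U×I₂≐U : ∀ {t} → 1 ≤ m → m ≤ n → t + m ≡ suc n →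
                         (F₂ H ≐ U n m) × (I₂ H ≐ U n t)
  Threshold⇒F₂≐U×I₂≐U 1≤m m≤n t+m≡1+n =
    Minimal≐U (Forcing⇔ 1≤m m≤n) , Minimal≐U (Immune⇔ t+m≡1+n m≤n)

complete₁-stuck : ∀ (S : Subset n) → Stuck (complete n 1) S
complete₁-stuck S = stuck-if-edges-⊆ λ where
  (E , _ , ∣E∣≡1 , (x , x∈X) , X⊆S , X⊆E , _) {y} y∈E →
    let E≡⁅x⁆ = sym (p⊆q∧∣q∣≤∣p∣⇒p≡q (x∈p⇒⁅x⁆⊆p (X⊆E x∈X))
                                      (≤-reflexive (trans ∣E∣≡1 (sym (∣⁅x⁆∣≡1 x)))))
    in x∈p⇒⁅x⁆⊆p (X⊆S x∈X) (subst (y ∈_) E≡⁅x⁆ y∈E)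

complete₁-threshold : Threshold (complete n 1) n
complete₁-threshold {n} B = closes⊤ , λ _ → complete₁-stuck B
  where
  closes⊤ : n ≤ ∣ B ∣ → ClosesTo⊤ (complete n 1) B
  closes⊤ n≤B = subst (ClosesTo⊤ _) (sym (∣p∣≡n⇒p≡⊤ (≤-antisym (∣p∣≤n B) n≤B))) ⊤-closes

completeₙ-step-⊤ : ∀ {S : Subset n} → Nonempty S → Step (complete n n) S ⊤
completeₙ-step-⊤ {n} {S} nonempty =
  ⊤ , S , ∣⊤∣≡n n , nonempty , (λ x∈S → x∈S) , ⊆⊤ ,
  (λ E' ∣E'∣≡n E'≢⊤ _ _ → E'≢⊤ (∣p∣≡n⇒p≡⊤ ∣E'∣≡n)) , sym (∪-zeroʳ S)

completeₙ-threshold : Threshold (complete n n) 1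
completeₙ-threshold B =
  (λ 1≤B → Step⊤⇒ClosesTo⊤ (completeₙ-step-⊤ (1≤∣p∣⇒Nonempty B 1≤B))) ,
  (λ B<1 → stuck-if-edges-⊆ λ where
    (_ , _ , _ , (x , x∈X) , X⊆B , _) → ⊥-elim (<⇒≱ B<1 (Nonempty⇒1≤∣p∣ (x , X⊆B x∈X))))

complete-stuck : ∀ {k} (S : Subset (suc n)) → k ≤ n → ∣ S ∣ < n → Stuck (complete (suc n) k) S
complete-stuck {n} {k} S k≤n S<n = stuck-if-edges-⊆ edge⊆S
  where
  edge⊆S : ∀ {S'} (s : Step (complete (suc n) k) S S') → proj₁ s ⊆ S
  edge⊆S (E , X , ∣E∣≡k , _ , X⊆S , X⊆E , unique , _) {w} w∈E with w ∈? S
  ... | yes w∈S = w∈S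
  ... | no w∉S = ⊥-elim (unique E' ∣E'∣≡k E'≢E (w' , w'∈E' , w'∉S) X⊆E')
    where
    second-white : ∃[ w' ] w' ∉ S × w' ≢ w
    second-white = ∣p∣<n∧x∉p⇒∃∉≢ S S<n w∉S
    w' = proj₁ second-white
    w'∉S = proj₁ (proj₂ second-white)
    w'≢w = proj₂ (proj₂ second-white)
    -- exchange w for a vertex u ∉ E, chosen so that the white w' survives
    exchange : ∃[ u ] u ∉ E × w' ∈ (E - w) ∪ ⁅ u ⁆
    exchange with w' ∈? E
    ... | yes w'∈E =
      let u , u∉E = ∣p∣<n⇒∃∉ E (subst (_< suc n) (sym ∣E∣≡k) (s≤s k≤n))
      in u , u∉E , p⊆p∪q ⁅ u ⁆ (x∈p∧x≢y⇒x∈p-y w'∈E w'≢w)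
    ... | no w'∉E = w' , w'∉E , q⊆p∪q (E - w) ⁅ w' ⁆ (x∈⁅x⁆ w')
    u = proj₁ exchange
    E' = (E - w) ∪ ⁅ u ⁆
    w'∈E' : w' ∈ E'
    w'∈E' = proj₂ (proj₂ exchange)
    ∣E'∣≡k : ∣ E' ∣ ≡ k
    ∣E'∣≡k = trans (x∈p∧y∉p⇒∣p-x∪⁅y⁆∣≡∣p∣ w∈E (proj₁ (proj₂ exchange))) ∣E∣≡k
    E'≢E : E' ≢ E
    E'≢E E'≡E = proj₁ (proj₂ exchange) (subst (u ∈_) E'≡E (q⊆p∪q (E - w) ⁅ u ⁆ (x∈⁅x⁆ u)))
    X⊆E' : X ⊆ E'
    X⊆E' x∈X = p⊆p∪q ⁅ u ⁆ (x∈p∧x≢y⇒x∈p-y (X⊆E x∈X) λ { refl → w∉S (X⊆S x∈X) })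

complete-step-⊤ : ∀ {k} → 1 ≤ k → k < n → ∀ (F : Subset (suc n)) → ∣ F ∣ ≡ n →
                  Step (complete (suc n) (suc k)) F ⊤
complete-step-⊤ {n} {k} 1≤k k<n F ∣F∣≡n =
  E , X , ∣E∣≡1+k , nonempty , X⊆F , p⊆p∪q ⁅ w ⁆ , unique , sym F∪E≡⊤
  where
  white : ∃[ w ] w ∉ F
  white = ∣p∣<n⇒∃∉ F (subst (_< suc n) (sym ∣F∣≡n) ≤-refl)
  w = proj₁ white
  w∉F = proj₂ white
  black-or-w : ∀ y → y ∈ F ⊎ y ∈ ⁅ w ⁆
  black-or-w y = x∈p∪q⁻ F ⁅ w ⁆ (subst (y ∈_) (sym F∪⁅w⁆≡⊤) ∈⊤)
    where
    F∪⁅w⁆≡⊤ : F ∪ ⁅ w ⁆ ≡ ⊤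
    F∪⁅w⁆≡⊤ = ∣p∣≡n⇒p≡⊤ (trans (x∉p⇒∣p∪⁅x⁆∣≡1+∣p∣ w∉F) (cong suc ∣F∣≡n))
  black-part = ∃⊆-of-size F (subst (k ≤_) (sym ∣F∣≡n) (<⇒≤ k<n))
  X = proj₁ black-part
  X⊆F = proj₁ (proj₂ black-part)
  ∣X∣≡k = proj₂ (proj₂ black-part)
  E = X ∪ ⁅ w ⁆
  ∣E∣≡1+k : ∣ E ∣ ≡ suc k
  ∣E∣≡1+k = trans (x∉p⇒∣p∪⁅x⁆∣≡1+∣p∣ (w∉F ∘ X⊆F)) (cong suc ∣X∣≡k)
  nonempty : Nonempty X
  nonempty = 1≤∣p∣⇒Nonempty X (subst (1 ≤_) (sym ∣X∣≡k) 1≤k)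
  unique : ∀ E' → complete (suc n) (suc k) E' → E' ≢ E → HasWhite F E' → ¬ (X ⊆ E')
  unique E' ∣E'∣≡1+k E'≢E (v , v∈E' , v∉F) X⊆E' =
    E'≢E (sym (p⊆q∧∣q∣≤∣p∣⇒p≡q E⊆E' (≤-reflexive (trans ∣E'∣≡1+k (sym ∣E∣≡1+k)))))
    where
    w∈E' : w ∈ E'
    w∈E' = [ ⊥-elim ∘ v∉F , (λ v∈⁅w⁆ → subst (_∈ E') (x∈⁅y⁆⇒x≡y w v∈⁅w⁆) v∈E') ]′ (black-or-w v)
    E⊆E' : E ⊆ E'
    E⊆E' y∈E = [ X⊆E' , (λ y∈⁅w⁆ → x∈p⇒⁅x⁆⊆p w∈E' y∈⁅w⁆) ]′ (x∈p∪q⁻ X ⁅ w ⁆ y∈E)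
  F∪E≡⊤ : F ∪ E ≡ ⊤
  F∪E≡⊤ = ⊆-antisym ⊆⊤ λ {y} _ → [ p⊆p∪q E , q⊆p∪q F E ∘ q⊆p∪q X ⁅ w ⁆ ]′ (black-or-w y)

complete-threshold : ∀ {k} → 2 ≤ k → k ≤ n → Threshold (complete (suc n) k) n
complete-threshold {n} {suc k} (s≤s 1≤k) k<n B = closes⊤ , complete-stuck B k<n
  where
  closes⊤ : n ≤ ∣ B ∣ → ClosesTo⊤ (complete (suc n) (suc k)) B
  closes⊤ n≤B with m≤n⇒m<n∨m≡n (∣p∣≤n B)
  ... | inj₁ B<1+n = Step⊤⇒ClosesTo⊤ (complete-step-⊤ 1≤k k<n B (≤-antisym (s≤s⁻¹ B<1+n) n≤B))
  ... | inj₂ B≡1+n = subst (ClosesTo⊤ _) (sym (∣p∣≡n⇒p≡⊤ B≡1+n)) ⊤-closes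

proposition8 :
    (∀ n → 1 ≤ n →
      (F₂ (complete n 1) ≐ U n n) × (I₂ (complete n 1) ≐ U n 1))
    × (∀ n k → 2 ≤ k → k + 1 ≤ n →
      (F₂ (complete n k) ≐ U n (n ∸ 1)) × (I₂ (complete n k) ≐ U n 2))
    × (∀ n → 1 ≤ n →
      (F₂ (complete n n) ≐ U n 1) × (I₂ (complete n n) ≐ U n n))
proposition8 = k≡1 , 2≤k<n , k≡n
  where
  k≡1 : ∀ n → 1 ≤ n → (F₂ (complete n 1) ≐ U n n) × (I₂ (complete n 1) ≐ U n 1)
  k≡1 n 1≤n = Threshold⇒F₂≐U×I₂≐U complete₁-threshold 1≤n ≤-refl refl
  2≤k<n : ∀ n k → 2 ≤ k → k + 1 ≤ n →
          (F₂ (complete n k) ≐ U n (n ∸ 1)) × (I₂ (complete n k) ≐ U n 2)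
  2≤k<n n       zero    ()
  2≤k<n zero    (suc k) _   ()
  2≤k<n (suc n) (suc k) 2≤k (s≤s k+1≤n) =
    Threshold⇒F₂≐U×I₂≐U (complete-threshold 2≤k 1+k≤n) (≤-trans (s≤s z≤n) 1+k≤n) (n≤1+n n) refl
    where
    1+k≤n : suc k ≤ n
    1+k≤n = subst (_≤ n) (+-comm k 1) k+1≤n
  k≡n : ∀ n → 1 ≤ n → (F₂ (complete n n) ≐ U n 1) × (I₂ (complete n n) ≐ U n n)
  k≡n n 1≤n = Threshold⇒F₂≐U×I₂≐U completeₙ-threshold ≤-refl 1≤n (+-comm n 1)
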